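{- For every natural number $N\ge 1$ there is at most one finite representation $N=\sum_{i} c_i\varphi^i$ with all digits $c_i\in\{0,1\}$, $c_1=c_0=1$, and $c_{i+1}c_i\ne 11$ for all $i\ne 0$. Consequently the canonical representation $\gamma(N)$ of $N$ is unique.
   Context: Let $\varphi=(1+\sqrt5)/2$. The Bergman representation $\beta(N)$ of a natural number $N$ is the unique finite expansion $N=\sum_i d_i\varphi^i$ with digits $d_i\in\{0,1\}$ and no two consecutive digits $d_{i+1}=d_i=1$. The canonical representation $\gamma(N)=c_L\dots c_1c_0\cdot c_{ -1}\dots c_R$ is defined as follows: if $N$ has a finite representation $N=\sum_i c_i\varphi^i$ with digits $c_i\in\{0,1\}$, $c_1c_0=11$, and $c_{i+1}c_i\ne 11$ for all $i\ne0$, then $\gamma(N)$ is such a representation; otherwise $\gamma(N)=\beta(N)$. -}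

module Defs where

open import Data.Nat as ℕ using (ℕ; zero; suc)
open import Data.Integer as ℤ using (ℤ; +_; -[1+_]; ∣_∣)
open import Data.Bool using (Bool; true; false)
open import Data.Product using (_×_)
open import Relation.Binary.PropositionalEquality using (_≡_; _≢_)
open import Relation.Nullary using (¬_)

-- Exact arithmetic in ℤ[φ], φ = (1+√5)/2.  The pair (a , b) denotes a + bφ.
-- Since 1 and φ are linearly independent over ℚ, equality of such numbers
-- is exactly propositional equality of the pairs.
record ℤφ : Set where
  constructor _,φ_
  field
    re : ℤ
    im : ℤ
open ℤφ public

0φ : ℤφ
0φ = (+ 0) ,φ (+ 0)

_+φ_ : ℤφ → ℤφ → ℤφ
(a ,φ b) +φ (c ,φ d) = (a ℤ.+ c) ,φ (b ℤ.+ d)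

-- (a + bφ)(c + dφ) = (ac + bd) + (ad + bc + bd)φ   using φ² = φ + 1
_*φ_ : ℤφ → ℤφ → ℤφ
(a ,φ b) *φ (c ,φ d) = (a ℤ.* c ℤ.+ b ℤ.* d) ,φ (a ℤ.* d ℤ.+ b ℤ.* c ℤ.+ b ℤ.* d)

embed : ℕ → ℤφ
embed N = (+ N) ,φ (+ 0)

φ : ℤφ
φ = (+ 0) ,φ (+ 1)

-- φ⁻¹ = φ - 1
φ⁻¹ : ℤφ
φ⁻¹ = -[1+ 0 ] ,φ (+ 1)

powφ : ℤφ → ℕ → ℤφ
powφ x zero = (+ 1) ,φ (+ 0)
powφ x (suc n) = x *φ powφ x n

φ^ : ℤ → ℤφ
φ^ (+ n) = powφ φ n
φ^ -[1+ n ] = powφ φ⁻¹ (suc n)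

-- A finite φ-expansion: digits c i ∈ {0,1} (false = 0, true = 1) indexed by
-- all integers i, together with a bound B such that c i = 0 whenever |i| > B.
record FinRep : Set where
  field
    digit   : ℤ → Bool
    bound   : ℕ
    finite  : ∀ i → bound ℕ.< ∣ i ∣ → digit i ≡ false
open FinRep public

digitVal : Bool → ℤφ → ℤφ
digitVal true  x = x
digitVal false x = 0φ

sumFrom : (ℤ → Bool) → ℕ → ℕ → ℤφ
sumFrom c B zero = 0φ
sumFrom c B (suc m) =
  digitVal (c ((+ m) ℤ.- (+ B))) (φ^ ((+ m) ℤ.- (+ B))) +φ sumFrom c B m

-- value of the expansion: Σ_{-B ≤ i ≤ B} c_i φ^i
value : FinRep → ℤφ
value r = sumFrom (digit r) (bound r) (suc (2 ℕ.* bound r))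

CanonicalDigits : FinRep → Set
CanonicalDigits r =
  (digit r (+ 1) ≡ true) × (digit r (+ 0) ≡ true) ×
  (∀ (i : ℤ) → i ≢ + 0 → ¬ ((digit r (i ℤ.+ + 1) ≡ true) × (digit r i ≡ true)))

-- Multiplying by a power φ^M moves all digits of both expansions to nonnegative positions.
-- The ℤ-linear map a + bφ ↦ a + 2b sends φⁿ to the Fibonacci number F(n+2), so it turns an
-- expansion into a sum of Fibonacci numbers F(k+2) with the same digits.  Deleting the block
-- of ones at positions M, M+1 (the shifted c₁c₀ = 11) leaves a string without adjacent ones,
-- that is, a Zeckendorf representation, and those are unique.
module Submission where

open import Defs
open import Data.Nat using (ℕ; _≥_)
open import Data.Integer using (ℤ)
open import Relation.Binary.PropositionalEquality using (_≡_)

open import Data.Nat using (zero; suc; _+_; _*_; _≤_; _<_; z≤n; s≤s)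
open import Data.Nat.Properties
  using ( _≟_; +-commutativeSemigroup; +-identityʳ; +-suc; +-comm; +-cancelˡ-≡; +-cancelʳ-≡
        ; ≤-refl; ≤-trans; <-≤-trans; <-irrefl; m≤m+n; m≤n+m; +-monoʳ-≤; +-monoʳ-<
        ; m<n⇒m<1+n; m<1+n⇒m<n∨m≡n; m≤n⇒∃[o]m+o≡n )
open import Algebra.Properties.CommutativeSemigroup +-commutativeSemigroup
  using (interchange; x∙yz≈y∙xz)
import Data.Nat.Tactic.RingSolver as ℕ-Solver
open import Data.Integer using (+_; -[1+_]; ∣_∣)
import Data.Integer as ℤ
import Data.Integer.Properties as ℤₚ
open import Data.Integer.Tactic.RingSolver using (solve-∀)
open import Data.Bool using (Bool; true; false; not; _∧_)
open import Data.Product using (_×_; _,_; proj₁; proj₂; ∃-syntax)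
open import Data.Sum using (_⊎_; inj₁; inj₂)
open import Data.Empty using (⊥-elim)
open import Function using (_∘_)
open import Relation.Nullary using (¬_; Dec; yes; no; does)
open import Relation.Nullary.Decidable using (_⊎-dec_)
open import Relation.Binary.PropositionalEquality
  using (refl; sym; trans; cong; cong₂; subst; _≢_; module ≡-Reasoning)

open ≡-Reasoning

fib : ℕ → ℕ
fib 0 = 0
fib 1 = 1
fib (suc (suc n)) = fib (suc n) + fib n

sumBelow : (ℕ → ℕ) → ℕ → ℕ
sumBelow f zero = 0
sumBelow f (suc n) = f n + sumBelow f n

sumBelow-cong : ∀ {f g} → (∀ k → f k ≡ g k) → ∀ n → sumBelow f n ≡ sumBelow g n
sumBelow-cong f≗g zero = refl
sumBelow-cong f≗g (suc n) = cong₂ _+_ (f≗g n) (sumBelow-cong f≗g n)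

sumBelow-distrib : ∀ f g n → sumBelow (λ k → f k + g k) n ≡ sumBelow f n + sumBelow g n
sumBelow-distrib f g zero = refl
sumBelow-distrib f g (suc n) =
  trans (cong (_+_ (f n + g n)) (sumBelow-distrib f g n)) (interchange (f n) (g n) _ _)

sumBelow-zero : ∀ {f} n → (∀ k → k < n → f k ≡ 0) → sumBelow f n ≡ 0
sumBelow-zero zero _ = refl
sumBelow-zero (suc n) f≡0 =
  cong₂ _+_ (f≡0 n ≤-refl) (sumBelow-zero n (λ k k<n → f≡0 k (m<n⇒m<1+n k<n)))

sumBelow-+ : ∀ f m n → sumBelow f (m + n) ≡ sumBelow f m + sumBelow (λ k → f (m + k)) n
sumBelow-+ f m zero = trans (cong (sumBelow f) (+-identityʳ m)) (sym (+-identityʳ _))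
sumBelow-+ f m (suc n) = begin
  sumBelow f (m + suc n)                                     ≡⟨ cong (sumBelow f) (+-suc m n) ⟩
  f (m + n) + sumBelow f (m + n)                             ≡⟨ cong (_+_ (f (m + n))) (sumBelow-+ f m n) ⟩
  f (m + n) + (sumBelow f m + sumBelow (λ k → f (m + k)) n)  ≡⟨ x∙yz≈y∙xz (f (m + n)) (sumBelow f m) _ ⟩
  sumBelow f m + (f (m + n) + sumBelow (λ k → f (m + k)) n)  ∎

sumBelow-window : ∀ f m n o →
  (∀ k → k < m → f k ≡ 0) → (∀ k → k < o → f (m + n + k) ≡ 0) →
  sumBelow f (m + n + o) ≡ sumBelow (λ k → f (m + k)) n
sumBelow-window f m n o below above = begin
  sumBelow f (m + n + o)
    ≡⟨ sumBelow-+ f (m + n) o ⟩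
  sumBelow f (m + n) + sumBelow (λ k → f (m + n + k)) o
    ≡⟨ cong (_+_ (sumBelow f (m + n))) (sumBelow-zero o above) ⟩
  sumBelow f (m + n) + 0
    ≡⟨ +-identityʳ _ ⟩
  sumBelow f (m + n)
    ≡⟨ sumBelow-+ f m n ⟩
  sumBelow f m + sumBelow (λ k → f (m + k)) n
    ≡⟨ cong (_+ sumBelow (λ k → f (m + k)) n) (sumBelow-zero m below) ⟩
  sumBelow (λ k → f (m + k)) n
    ∎

digitValℕ : Bool → ℕ → ℕ
digitValℕ true  x = x
digitValℕ false x = 0

digitValℕ-false : ∀ {b} x → b ≡ false → digitValℕ b x ≡ 0
digitValℕ-false x refl = refl

zeck : (ℕ → Bool) → ℕ → ℕ
zeck e = sumBelow (λ k → digitValℕ (e k) (fib (2 + k)))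

AdjacentOnesAt : (ℕ → Bool) → ℕ → Set
AdjacentOnesAt e k = e (suc k) ≡ true × e k ≡ true

NoAdjacentOnes : (ℕ → Bool) → Set
NoAdjacentOnes e = ∀ k → ¬ AdjacentOnesAt e k

top-digits-bound : ∀ b₁ b₀ n {s} → ¬ (b₁ ≡ true × b₀ ≡ true) →
  digitValℕ b₀ (fib (2 + n)) + s < fib (3 + n) → s < fib (2 + n) →
  digitValℕ b₁ (fib (3 + n)) + (digitValℕ b₀ (fib (2 + n)) + s) < fib (4 + n)
top-digits-bound false _     n _   lower _ = <-≤-trans lower (m≤m+n _ _)
top-digits-bound true  true  n adj _     _ = ⊥-elim (adj (refl , refl))
top-digits-bound true  false n _   _ s<fib = +-monoʳ-< (fib (3 + n)) s<fib

zeck<fib : ∀ {e} → NoAdjacentOnes e → ∀ n → zeck e n < fib (2 + n)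
zeck<fib h zero = s≤s z≤n
zeck<fib {e} h (suc zero) with e 0
... | true  = s≤s (s≤s z≤n)
... | false = s≤s z≤n
zeck<fib {e} h (suc (suc n)) =
  top-digits-bound (e (suc n)) (e n) n (h n) (zeck<fib h (suc n)) (zeck<fib h n)

fib+≢zeck : ∀ {e} → NoAdjacentOnes e → ∀ n x → fib (2 + n) + x ≢ zeck e n
fib+≢zeck h n x eq =
  <-irrefl refl (<-≤-trans (zeck<fib h n) (subst (fib (2 + n) ≤_) eq (m≤m+n _ x)))

zeck-suc-injective : ∀ {e e'} → NoAdjacentOnes e → NoAdjacentOnes e' → ∀ n →
  zeck e (suc n) ≡ zeck e' (suc n) → e n ≡ e' n × zeck e n ≡ zeck e' n
zeck-suc-injective {e} {e'} h h' n eq with e n | e' n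
... | true  | true  = refl , +-cancelˡ-≡ (fib (2 + n)) _ _ eq
... | false | false = refl , eq
... | true  | false = ⊥-elim (fib+≢zeck h' n _ eq)
... | false | true  = ⊥-elim (fib+≢zeck h n _ (sym eq))

zeck-injective : ∀ {e e'} → NoAdjacentOnes e → NoAdjacentOnes e' → ∀ n →
  zeck e n ≡ zeck e' n → ∀ k → k < n → e k ≡ e' k
zeck-injective h h' (suc n) eq k k<1+n
  with m<1+n⇒m<n∨m≡n k<1+n | zeck-suc-injective h h' n eq
... | inj₁ k<n  | _ , eq' = zeck-injective h h' n eq' k k<n
... | inj₂ refl | eₙ≡e'ₙ , _ = eₙ≡e'ₙ

module _ {A : Set} where

  digitValℕ-mask : ∀ (a? : Dec A) {b} x → (A → b ≡ true) →
    digitValℕ b x ≡ digitValℕ (not (does a?) ∧ b) x + digitValℕ (does a?) x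
  digitValℕ-mask (yes a) x b≡true rewrite b≡true a = refl
  digitValℕ-mask (no _)  x _ = sym (+-identityʳ _)

  mask-true : ∀ (a? : Dec A) {b} → not (does a?) ∧ b ≡ true → ¬ A × b ≡ true
  mask-true (yes _) ()
  mask-true (no ¬a) b≡true = ¬a , b≡true

  mask-injective : ∀ (a? : Dec A) {b b'} → (A → b ≡ true) → (A → b' ≡ true) →
    not (does a?) ∧ b ≡ not (does a?) ∧ b' → b ≡ b'
  mask-injective (yes a) b≡true b'≡true _ = trans (b≡true a) (sym (b'≡true a))
  mask-injective (no _)  _ _ eq = eq

OnlyAdjacentOnesAt : ℕ → (ℕ → Bool) → Set
OnlyAdjacentOnesAt p e = AdjacentOnesAt e p × (∀ k → k ≢ p → ¬ AdjacentOnesAt e k)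

inPair? : ∀ p k → Dec (k ≡ p ⊎ k ≡ suc p)
inPair? p k = k ≟ p ⊎-dec k ≟ suc p

pairDigits : ℕ → ℕ → Bool
pairDigits p k = does (inPair? p k)

clearPair : ℕ → (ℕ → Bool) → ℕ → Bool
clearPair p e k = not (pairDigits p k) ∧ e k

module _ {p : ℕ} {e : ℕ → Bool} (h : OnlyAdjacentOnesAt p e) where

  pair-true : ∀ {k} → k ≡ p ⊎ k ≡ suc p → e k ≡ true
  pair-true (inj₁ refl) = proj₂ (proj₁ h)
  pair-true (inj₂ refl) = proj₁ (proj₁ h)

  clearPair-noAdjacentOnes : NoAdjacentOnes (clearPair p e)
  clearPair-noAdjacentOnes k (c₁ , c₀) =
    proj₂ h k (proj₁ (mask-true (inPair? p k) c₀) ∘ inj₁)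
      (proj₂ (mask-true (inPair? p (suc k)) c₁) , proj₂ (mask-true (inPair? p k) c₀))

  zeck-clearPair : ∀ n → zeck e n ≡ zeck (clearPair p e) n + zeck (pairDigits p) n
  zeck-clearPair n =
    trans (sumBelow-cong (λ k → digitValℕ-mask (inPair? p k) _ pair-true) n) (sumBelow-distrib _ _ n)

onlyAdjacentOnesAt-zeck-injective : ∀ {p e e'} → OnlyAdjacentOnesAt p e → OnlyAdjacentOnesAt p e' →
  ∀ n → zeck e n ≡ zeck e' n → ∀ k → k < n → e k ≡ e' k
onlyAdjacentOnesAt-zeck-injective {p} {e} {e'} h h' n eq k k<n =
  mask-injective (inPair? p k) (pair-true h) (pair-true h')
    (zeck-injective (clearPair-noAdjacentOnes h) (clearPair-noAdjacentOnes h') n cleared k k<n)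
  where
  cleared : zeck (clearPair p e) n ≡ zeck (clearPair p e') n
  cleared = +-cancelʳ-≡ _ _ _ (begin
    zeck (clearPair p e) n + _   ≡⟨ zeck-clearPair h n ⟨
    zeck e n                     ≡⟨ eq ⟩
    zeck e' n                    ≡⟨ zeck-clearPair h' n ⟩
    zeck (clearPair p e') n + _  ∎)

mulPowφ : ℕ → ℤφ → ℤφ
mulPowφ zero    x = x
mulPowφ (suc n) x = φ *φ mulPowφ n x

φ*-distrib-+φ : ∀ x y → φ *φ (x +φ y) ≡ (φ *φ x) +φ (φ *φ y)
φ*-distrib-+φ (a ,φ b) (c ,φ d) = cong₂ _,φ_ (re≡ a b c d) (im≡ a b c d)
  where
  re≡ : ∀ a b c d → + 0 ℤ.* (a ℤ.+ c) ℤ.+ + 1 ℤ.* (b ℤ.+ d)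
                 ≡ (+ 0 ℤ.* a ℤ.+ + 1 ℤ.* b) ℤ.+ (+ 0 ℤ.* c ℤ.+ + 1 ℤ.* d)
  re≡ = solve-∀
  im≡ : ∀ a b c d → + 0 ℤ.* (b ℤ.+ d) ℤ.+ + 1 ℤ.* (a ℤ.+ c) ℤ.+ + 1 ℤ.* (b ℤ.+ d)
                 ≡ (+ 0 ℤ.* b ℤ.+ + 1 ℤ.* a ℤ.+ + 1 ℤ.* b) ℤ.+ (+ 0 ℤ.* d ℤ.+ + 1 ℤ.* c ℤ.+ + 1 ℤ.* d)
  im≡ = solve-∀

φ*φ* : ∀ x → φ *φ (φ *φ x) ≡ (φ *φ x) +φ x
φ*φ* (a ,φ b) = cong₂ _,φ_ (re≡ a b) (im≡ a b)
  where
  re≡ : ∀ a b → + 0 ℤ.* (+ 0 ℤ.* a ℤ.+ + 1 ℤ.* b) ℤ.+ + 1 ℤ.* (+ 0 ℤ.* b ℤ.+ + 1 ℤ.* a ℤ.+ + 1 ℤ.* b)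
             ≡ (+ 0 ℤ.* a ℤ.+ + 1 ℤ.* b) ℤ.+ a
  re≡ = solve-∀
  im≡ : ∀ a b → + 0 ℤ.* (+ 0 ℤ.* b ℤ.+ + 1 ℤ.* a ℤ.+ + 1 ℤ.* b) ℤ.+ + 1 ℤ.* (+ 0 ℤ.* a ℤ.+ + 1 ℤ.* b)
                 ℤ.+ + 1 ℤ.* (+ 0 ℤ.* b ℤ.+ + 1 ℤ.* a ℤ.+ + 1 ℤ.* b)
             ≡ (+ 0 ℤ.* b ℤ.+ + 1 ℤ.* a ℤ.+ + 1 ℤ.* b) ℤ.+ b
  im≡ = solve-∀

φ*φ⁻¹* : ∀ x → φ *φ (φ⁻¹ *φ x) ≡ x
φ*φ⁻¹* (a ,φ b) = cong₂ _,φ_ (re≡ a b) (im≡ a b)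
  where
  re≡ : ∀ a b → + 0 ℤ.* (ℤ.- + 1 ℤ.* a ℤ.+ + 1 ℤ.* b) ℤ.+ + 1 ℤ.* (ℤ.- + 1 ℤ.* b ℤ.+ + 1 ℤ.* a ℤ.+ + 1 ℤ.* b)
             ≡ a
  re≡ = solve-∀
  im≡ : ∀ a b → + 0 ℤ.* (ℤ.- + 1 ℤ.* b ℤ.+ + 1 ℤ.* a ℤ.+ + 1 ℤ.* b) ℤ.+ + 1 ℤ.* (ℤ.- + 1 ℤ.* a ℤ.+ + 1 ℤ.* b)
                 ℤ.+ + 1 ℤ.* (ℤ.- + 1 ℤ.* b ℤ.+ + 1 ℤ.* a ℤ.+ + 1 ℤ.* b)
             ≡ b
  im≡ = solve-∀

φ*φ^ : ∀ i → φ *φ φ^ i ≡ φ^ (i ℤ.+ + 1)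
φ*φ^ (+ n)        = cong (powφ φ) (+-comm 1 n)
φ*φ^ -[1+ zero ]  = φ*φ⁻¹* _
φ*φ^ -[1+ suc n ] = φ*φ⁻¹* _

mulPowφ-+φ : ∀ n x y → mulPowφ n (x +φ y) ≡ mulPowφ n x +φ mulPowφ n y
mulPowφ-+φ zero    x y = refl
mulPowφ-+φ (suc n) x y =
  trans (cong (φ *φ_) (mulPowφ-+φ n x y)) (φ*-distrib-+φ (mulPowφ n x) (mulPowφ n y))

mulPowφ-0φ : ∀ n → mulPowφ n 0φ ≡ 0φ
mulPowφ-0φ zero    = refl
mulPowφ-0φ (suc n) = cong (φ *φ_) (mulPowφ-0φ n)

mulPowφ-φ^ : ∀ n i → mulPowφ n (φ^ i) ≡ φ^ (i ℤ.+ + n)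
mulPowφ-φ^ zero    i = cong φ^ (sym (ℤₚ.+-identityʳ i))
mulPowφ-φ^ (suc n) i = begin
  φ *φ mulPowφ n (φ^ i)   ≡⟨ cong (φ *φ_) (mulPowφ-φ^ n i) ⟩
  φ *φ φ^ (i ℤ.+ + n)     ≡⟨ φ*φ^ (i ℤ.+ + n) ⟩
  φ^ (i ℤ.+ + n ℤ.+ + 1)  ≡⟨ cong φ^ (ℤₚ.+-assoc i (+ n) (+ 1)) ⟩
  φ^ (i ℤ.+ + (n + 1))    ≡⟨ cong (λ m → φ^ (i ℤ.+ + m)) (+-comm n 1) ⟩
  φ^ (i ℤ.+ + suc n)      ∎

-- The ℤ-linear functional a + bφ ↦ a + 2b: it sends φⁿ to F(n+2), the Zeckendorf weights.
weight : ℤφ → ℤ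
weight (a ,φ b) = a ℤ.+ (b ℤ.+ b)

weight-+φ : ∀ x y → weight (x +φ y) ≡ weight x ℤ.+ weight y
weight-+φ (a ,φ b) (c ,φ d) = lemma a b c d
  where
  lemma : ∀ a b c d → (a ℤ.+ c) ℤ.+ ((b ℤ.+ d) ℤ.+ (b ℤ.+ d)) ≡ (a ℤ.+ (b ℤ.+ b)) ℤ.+ (c ℤ.+ (d ℤ.+ d))
  lemma = solve-∀

weight-powφ : ∀ n → weight (powφ φ n) ≡ + fib (2 + n)
weight-powφ zero          = refl
weight-powφ (suc zero)    = refl
weight-powφ (suc (suc n)) = begin
  weight (φ *φ (φ *φ powφ φ n))                  ≡⟨ cong weight (φ*φ* (powφ φ n)) ⟩
  weight (powφ φ (suc n) +φ powφ φ n)            ≡⟨ weight-+φ (powφ φ (suc n)) (powφ φ n) ⟩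
  weight (powφ φ (suc n)) ℤ.+ weight (powφ φ n)  ≡⟨ cong₂ ℤ._+_ (weight-powφ (suc n)) (weight-powφ n) ⟩
  + fib (3 + n) ℤ.+ + fib (2 + n)                ≡⟨ ℤₚ.pos-+ (fib (3 + n)) (fib (2 + n)) ⟨
  + fib (4 + n)                                  ∎

weight-mulPowφ-sumFrom : ∀ c B D n →
  weight (mulPowφ (B + D) (sumFrom c B n))
    ≡ + sumBelow (λ k → digitValℕ (c (+ k ℤ.- + B)) (fib (2 + (D + k)))) n
weight-mulPowφ-sumFrom c B D zero = cong weight (mulPowφ-0φ (B + D))
weight-mulPowφ-sumFrom c B D (suc n) = begin
  weight (mulPowφ (B + D) (term +φ sumFrom c B n))
    ≡⟨ cong weight (mulPowφ-+φ (B + D) term (sumFrom c B n)) ⟩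
  weight (mulPowφ (B + D) term +φ mulPowφ (B + D) (sumFrom c B n))
    ≡⟨ weight-+φ (mulPowφ (B + D) term) (mulPowφ (B + D) (sumFrom c B n)) ⟩
  weight (mulPowφ (B + D) term) ℤ.+ weight (mulPowφ (B + D) (sumFrom c B n))
    ≡⟨ cong₂ ℤ._+_ (weight-term (c (+ n ℤ.- + B))) (weight-mulPowφ-sumFrom c B D n) ⟩
  + summand n ℤ.+ + sumBelow summand n
    ≡⟨ ℤₚ.pos-+ (summand n) (sumBelow summand n) ⟨
  + sumBelow summand (suc n) ∎
  where
  summand : ℕ → ℕ
  summand k = digitValℕ (c (+ k ℤ.- + B)) (fib (2 + (D + k)))

  term : ℤφ
  term = digitVal (c (+ n ℤ.- + B)) (φ^ (+ n ℤ.- + B))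

  exponent : ∀ n b d → (n ℤ.- b) ℤ.+ (b ℤ.+ d) ≡ d ℤ.+ n
  exponent = solve-∀

  weight-term : ∀ b → weight (mulPowφ (B + D) (digitVal b (φ^ (+ n ℤ.- + B))))
                    ≡ + digitValℕ b (fib (2 + (D + n)))
  weight-term true  = begin
    weight (mulPowφ (B + D) (φ^ (+ n ℤ.- + B)))   ≡⟨ cong weight (mulPowφ-φ^ (B + D) (+ n ℤ.- + B)) ⟩
    weight (φ^ ((+ n ℤ.- + B) ℤ.+ + (B + D)))     ≡⟨ cong (weight ∘ φ^) (exponent (+ n) (+ B) (+ D)) ⟩
    weight (powφ φ (D + n))                       ≡⟨ weight-powφ (D + n) ⟩
    + fib (2 + (D + n))                           ∎
  weight-term false = cong weight (mulPowφ-0φ (B + D))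

finite-below : ∀ t x → digit t -[1+ bound t + x ] ≡ false
finite-below t x = finite t _ (s≤s (m≤m+n (bound t) x))

finite-above : ∀ t x → digit t (+ suc (bound t + x)) ≡ false
finite-above t x = finite t _ (s≤s (m≤m+n (bound t) x))

shiftDigits : FinRep → ℕ → ℕ → Bool
shiftDigits t M j = digit t (+ j ℤ.- + M)

weight-mulPowφ-value : ∀ t M → bound t ≤ M →
  weight (mulPowφ M (value t)) ≡ + zeck (shiftDigits t M) (suc (2 * M))
weight-mulPowφ-value t M B≤M with m≤n⇒∃[o]m+o≡n B≤M
... | D , refl = trans (weight-mulPowφ-sumFrom (digit t) B D (suc (2 * B))) (cong +_ (sym window))
  where
  B : ℕ
  B = bound t

  f : ℕ → ℕ
  f j = digitValℕ (shiftDigits t (B + D) j) (fib (2 + j))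

  length : ∀ b d → d + suc (2 * b) + d ≡ suc (2 * (b + d))
  length = ℕ-Solver.solve-∀

  below : ∀ j → j < D → f j ≡ 0
  below j j<D with m≤n⇒∃[o]m+o≡n j<D
  ... | x , refl = digitValℕ-false _
        (subst (λ i → digit t i ≡ false) (sym (index (+ j) (+ B) (+ x))) (finite-below t x))
    where
    index : ∀ j b x → j ℤ.- (b ℤ.+ (+ 1 ℤ.+ (j ℤ.+ x))) ≡ ℤ.- (+ 1 ℤ.+ (b ℤ.+ x))
    index = solve-∀

  above : ∀ k → k < D → f (D + suc (2 * B) + k) ≡ 0
  above k _ = digitValℕ-false _
    (subst (λ i → digit t i ≡ false) (sym (index (+ B) (+ D) (+ k))) (finite-above t k))
    where
    index : ∀ b d k → (d ℤ.+ (+ 1 ℤ.+ (b ℤ.+ (b ℤ.+ + 0))) ℤ.+ k) ℤ.- (b ℤ.+ d) ≡ + 1 ℤ.+ (b ℤ.+ k)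
    index = solve-∀

  shifted : ∀ k → f (D + k) ≡ digitValℕ (digit t (+ k ℤ.- + B)) (fib (2 + (D + k)))
  shifted k = cong (λ i → digitValℕ (digit t i) (fib (2 + (D + k)))) (index (+ k) (+ B) (+ D))
    where
    index : ∀ k b d → (d ℤ.+ k) ℤ.- (b ℤ.+ d) ≡ k ℤ.- b
    index = solve-∀

  window : zeck (shiftDigits t (B + D)) (suc (2 * (B + D)))
         ≡ sumBelow (λ k → digitValℕ (digit t (+ k ℤ.- + B)) (fib (2 + (D + k)))) (suc (2 * B))
  window = begin
    sumBelow f (suc (2 * (B + D)))              ≡⟨ cong (sumBelow f) (length B D) ⟨
    sumBelow f (D + suc (2 * B) + D)            ≡⟨ sumBelow-window f D (suc (2 * B)) D below above ⟩
    sumBelow (λ k → f (D + k)) (suc (2 * B))    ≡⟨ sumBelow-cong shifted (suc (2 * B)) ⟩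
    _                                           ∎

shiftDigits-onlyAdjacentOnesAt : ∀ t M → CanonicalDigits t → OnlyAdjacentOnesAt M (shiftDigits t M)
shiftDigits-onlyAdjacentOnesAt t M (c₁ , c₀ , noOther) = (at-suc-M , at-M) , elsewhere
  where
  suc-index : ∀ k m → (+ 1 ℤ.+ k) ℤ.- m ≡ (k ℤ.- m) ℤ.+ + 1
  suc-index = solve-∀

  one-index : ∀ m → (+ 1 ℤ.+ m) ℤ.- m ≡ + 1
  one-index = solve-∀

  at-M : digit t (+ M ℤ.- + M) ≡ true
  at-M = subst (λ i → digit t i ≡ true) (sym (ℤₚ.+-inverseʳ (+ M))) c₀

  at-suc-M : digit t (+ suc M ℤ.- + M) ≡ true
  at-suc-M = subst (λ i → digit t i ≡ true) (sym (one-index (+ M))) c₁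

  elsewhere : ∀ k → k ≢ M → ¬ AdjacentOnesAt (shiftDigits t M) k
  elsewhere k k≢M (e₁ , e₀) =
    noOther (+ k ℤ.- + M) (k≢M ∘ ℤₚ.+-injective ∘ ℤₚ.i-j≡0⇒i≡j (+ k) (+ M))
      (subst (λ i → digit t i ≡ true) (suc-index (+ k) (+ M)) e₁ , e₀)

window-index : ∀ i M → ∣ i ∣ ≤ M → ∃[ j ] j < suc (2 * M) × + j ℤ.- + M ≡ i
window-index (+ n) M n≤M =
  M + n , s≤s (+-monoʳ-≤ M (subst (n ≤_) (sym (+-identityʳ M)) n≤M)) , index (+ M) (+ n)
  where
  index : ∀ m n → (m ℤ.+ n) ℤ.- m ≡ n
  index = solve-∀
window-index -[1+ n ] M 1+n≤M with m≤n⇒∃[o]m+o≡n 1+n≤M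
... | x , refl = x , s≤s (≤-trans (m≤n+m x (suc n)) (m≤m+n _ _)) , index (+ n) (+ x)
  where
  index : ∀ n x → x ℤ.- (+ 1 ℤ.+ (n ℤ.+ x)) ≡ ℤ.- (+ 1 ℤ.+ n)
  index = solve-∀

canonicalDigits-unique : ∀ r s → CanonicalDigits r → CanonicalDigits s →
  value r ≡ value s → ∀ i → digit r i ≡ digit s i
canonicalDigits-unique r s cr cs r≡s i =
  let j , j<window , j-M≡i = window-index i M (m≤n+m ∣ i ∣ _)
  in subst (λ i → digit r i ≡ digit s i) j-M≡i
       (onlyAdjacentOnesAt-zeck-injective
         (shiftDigits-onlyAdjacentOnesAt r M cr) (shiftDigits-onlyAdjacentOnesAt s M cs)
         (suc (2 * M)) zeck-eq j j<window)
  where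
  M : ℕ
  M = bound r + bound s + ∣ i ∣
  zeck-eq : zeck (shiftDigits r M) (suc (2 * M)) ≡ zeck (shiftDigits s M) (suc (2 * M))
  zeck-eq = ℤₚ.+-injective (begin
    + zeck (shiftDigits r M) (suc (2 * M))  ≡⟨ weight-mulPowφ-value r M r≤M ⟨
    weight (mulPowφ M (value r))            ≡⟨ cong (weight ∘ mulPowφ M) r≡s ⟩
    weight (mulPowφ M (value s))            ≡⟨ weight-mulPowφ-value s M s≤M ⟩
    + zeck (shiftDigits s M) (suc (2 * M))  ∎)
    where
    r≤M : bound r ≤ M
    r≤M = ≤-trans (m≤m+n (bound r) (bound s)) (m≤m+n _ ∣ i ∣)
    s≤M : bound s ≤ M
    s≤M = ≤-trans (m≤n+m (bound s) (bound r)) (m≤m+n _ ∣ i ∣)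

proposition2 : ∀ (N : ℕ) → N ≥ 1 → ∀ (r s : FinRep) →
    CanonicalDigits r → CanonicalDigits s →
    value r ≡ embed N → value s ≡ embed N →
    ∀ (i : ℤ) → digit r i ≡ digit s i
proposition2 N _ r s cr cs r≡N s≡N = canonicalDigits-unique r s cr cs (trans r≡N (sym s≡N))
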